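{- Let $\Sigma$ be a finite signature and $\mathcal{T}$ any $\Sigma$-theory. If $L_1$ and $L_2$ are $\mathcal{T}$-regular $\mathcal{T}$-languages, then their concatenation $L_1\cdot L_2$, i.e. the set of $\mathcal{T}$-words $\bar\sigma$ that can be written as $\bar\sigma=\bar\sigma_1\bar\sigma_2$ (sequence concatenation) with $\bar\sigma_1\in L_1$ and $\bar\sigma_2\in L_2$, is $\mathcal{T}$-regular.
   Context: Signatures are multi-sorted first-order signatures in which every symbol is marked either rigid or non-rigid. For a signature $\Sigma$, $\Sigma'$ denotes the signature obtained from $\Sigma$ by replacing each non-rigid symbol $s$ by a fresh primed copy $s'$ (rigid symbols are kept); for a $\Sigma$-structure $\sigma$, $\sigma'$ denotes the corresponding renamed $\Sigma'$-structure. For structures over pairwise disjoint signatures with the same sort domains, $\rho\cup\sigma\cup\tau'$ denotes the combined structure over the union of the signatures. A $\Sigma$-theory $\mathcal{T}$ is a set of $\Sigma$-sentences; $[\![\mathcal{T}]\!]$ is the set of all $\Sigma$-structures with finite or countably infinite domains that satisfy $\mathcal{T}$. A $\mathcal{T}$-word is a finite sequence $\bar\sigma=\langle\sigma_0,\ldots,\sigma_{n-1}\rangle$ ($n\ge 0$) of elements of $[\![\mathcal{T}]\!]$ such that for every sort $S$ and every rigid symbol $s$ of $\Sigma$, $S^{\sigma_i}=S^{\sigma_j}$ and $s^{\sigma_i}=s^{\sigma_j}$ for all $i,j$. $[\![\mathcal{T}]\!]^*$ is the set of all $\mathcal{T}$-words; a $\mathcal{T}$-language is a subset of $[\![\mathcal{T}]\!]^*$.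 A first-order automaton is a tuple $\mathcal{A}=\langle\Sigma,\Gamma,\phi_0,\phi_T,\phi_F\rangle$ where $\Sigma$ (word signature) and $\Gamma$ (state signature) are finite disjoint signatures, $\phi_0$ and $\phi_F$ are first-order $\Gamma$-sentences, and $\phi_T$ is a first-order $(\Gamma\cup\Sigma\cup\Gamma')$-sentence. Given a $\mathcal{T}$-word $\bar\sigma=\langle\sigma_0,\ldots,\sigma_{n-1}\rangle$, a $\mathcal{T}$-run of $\mathcal{A}$ induced by $\bar\sigma$ is a sequence $\langle\rho_0,\ldots,\rho_n\rangle$ of $\Gamma$-structures such that $S^{\rho_i}=S^{\sigma_0}$ for every sort $S$ and every $i$, rigid symbols of $\Gamma$ are interpreted identically in all $\rho_i$, $\rho_0\models\phi_0$, and $\rho_i\cup\sigma_i\cup\rho'_{i+1}\models\phi_T$ for all $0\le i<n$. $\mathcal{A}$ $\mathcal{T}$-accepts $\bar\sigma$ iff some such run satisfies $\rho_n\models\phi_F$. $\mathcal{L}_{\mathcal{T}}(\mathcal{A})$ is the set of $\mathcal{T}$-words $\mathcal{T}$-accepted by $\mathcal{A}$. A $\mathcal{T}$-language $L$ is $\mathcal{T}$-regular iff $L=\mathcal{L}_{\mathcal{T}}(\mathcal{A})$ for some first-order automaton $\mathcal{A}$ with word signature $\Sigma$. -}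

module Defs where

open import Level using (Level; 0ℓ) renaming (suc to lsuc)
open import Data.Nat using (ℕ)
open import Data.Fin using (Fin)
open import Data.Bool using (Bool; true; false)
open import Data.List using (List; []; _∷_; _++_; length)
open import Data.List.Membership.Propositional using (_∈_)
open import Data.List.Relation.Unary.All using (All; []; _∷_; lookup)
import Data.List as L
open import Data.Product using (Σ; _×_; _,_; proj₁; proj₂)
open import Data.Sum using (_⊎_; inj₁; inj₂)
open import Data.Empty using (⊥)
open import Data.Unit using (⊤)
open import Relation.Nullary using (¬_)
open import Relation.Binary.PropositionalEquality using (_≡_)
open import Function.Bundles using (_↔_; _⇔_)
open import Function.Definitions using (Injective)

-- Multi-sorted signatures over the sorts Fin n, every symbol marked
-- rigid (true) or non-rigid (false).  Constants are 0-ary functions.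

record Sig (n : ℕ) : Set₁ where
  field
    FSym   : Set
    RSym   : Set
    fArgs  : FSym → List (Fin n)
    fRes   : FSym → Fin n
    rArgs  : RSym → List (Fin n)
    fRigid : FSym → Bool
    rRigid : RSym → Bool
open Sig public

Finite : ∀ {n} → Sig n → Set
Finite V = Σ ℕ (λ k → FSym V ↔ Fin k) × Σ ℕ (λ k → RSym V ↔ Fin k)

_⊕_ : ∀ {n} → Sig n → Sig n → Sig n
V ⊕ W = record
  { FSym = FSym V ⊎ FSym W
  ; RSym = RSym V ⊎ RSym W
  ; fArgs = λ { (inj₁ f) → fArgs V f ; (inj₂ f) → fArgs W f }
  ; fRes  = λ { (inj₁ f) → fRes V f ; (inj₂ f) → fRes W f }
  ; rArgs = λ { (inj₁ r) → rArgs V r ; (inj₂ r) → rArgs W r }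
  ; fRigid = λ { (inj₁ f) → fRigid V f ; (inj₂ f) → fRigid W f }
  ; rRigid = λ { (inj₁ r) → rRigid V r ; (inj₂ r) → rRigid W r }
  }

-- The primed copies of the NON-RIGID symbols of V (rigid symbols are
-- kept unprimed, so V' only contributes fresh copies of non-rigid ones).
primedNR : ∀ {n} → Sig n → Sig n
primedNR V = record
  { FSym = Σ (FSym V) (λ f → fRigid V f ≡ false)
  ; RSym = Σ (RSym V) (λ r → rRigid V r ≡ false)
  ; fArgs = λ f → fArgs V (proj₁ f)
  ; fRes  = λ f → fRes V (proj₁ f)
  ; rArgs = λ r → rArgs V (proj₁ r)
  ; fRigid = λ _ → false
  ; rRigid = λ _ → false
  }

TransSig : ∀ {n} → Sig n → Sig n → Sig n
TransSig Γ S = (Γ ⊕ S) ⊕ primedNR Γ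

Ctx : ℕ → Set
Ctx n = List (Fin n)

module _ {n : ℕ} (V : Sig n) where
  mutual
    data Term (Δ : Ctx n) : Fin n → Set where
      var : ∀ {s} → s ∈ Δ → Term Δ s
      app : (f : FSym V) → Terms Δ (fArgs V f) → Term Δ (fRes V f)

    data Terms (Δ : Ctx n) : List (Fin n) → Set where
      []  : Terms Δ []
      _∷_ : ∀ {s ss} → Term Δ s → Terms Δ ss → Terms Δ (s ∷ ss)

  data Formula (Δ : Ctx n) : Set where
    atom : (r : RSym V) → Terms Δ (rArgs V r) → Formula Δ
    eq   : ∀ {s} → Term Δ s → Term Δ s → Formula Δ
    tt ff : Formula Δ
    not  : Formula Δ → Formula Δ
    and or imp : Formula Δ → Formula Δ → Formula Δ
    all ex : (s : Fin n) → Formula (s ∷ Δ) → Formula Δ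

  Sentence : Set
  Sentence = Formula []

record Interp {n : ℕ} (V : Sig n) (D : Fin n → Set) : Set₁ where
  field
    fun : (f : FSym V) → All D (fArgs V f) → D (fRes V f)
    rel : (r : RSym V) → All D (rArgs V r) → Set
open Interp public

record Structure {n : ℕ} (V : Sig n) : Set₁ where
  field
    Dom      : Fin n → Set
    nonempty : (s : Fin n) → Dom s
    interp   : Interp V Dom
open Structure public

module _ {n : ℕ} {V : Sig n} {D : Fin n → Set} (I : Interp V D) where
  mutual
    evalT : ∀ {Δ s} → All D Δ → Term V Δ s → D s
    evalT ρ (var x)    = lookup ρ x
    evalT ρ (app f ts) = fun I f (evalTs ρ ts)

    evalTs : ∀ {Δ ss} → All D Δ → Terms V Δ ss → All D ss
    evalTs ρ []       = []
    evalTs ρ (t ∷ ts) = evalT ρ t ∷ evalTs ρ ts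

  Sat : ∀ {Δ} → All D Δ → Formula V Δ → Set
  Sat ρ (atom r ts) = Interp.rel I r (evalTs ρ ts)
  Sat ρ (eq t u)   = evalT ρ t ≡ evalT ρ u
  Sat ρ tt         = ⊤
  Sat ρ ff         = ⊥
  Sat ρ (not φ)    = ¬ Sat ρ φ
  Sat ρ (and φ ψ)  = Sat ρ φ × Sat ρ ψ
  Sat ρ (or φ ψ)   = Sat ρ φ ⊎ Sat ρ ψ
  Sat ρ (imp φ ψ)  = Sat ρ φ → Sat ρ ψ
  Sat ρ (all s φ)  = (d : D s) → Sat (d ∷ ρ) φ
  Sat ρ (ex s φ)   = Σ (D s) (λ d → Sat (d ∷ ρ) φ)

  _⊨_ : Sentence V → Set
  _⊨_ φ = Sat [] φ

combine : ∀ {n} {Γ S : Sig n} {D : Fin n → Set} →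
          Interp Γ D → Interp S D → Interp Γ D → Interp (TransSig Γ S) D
combine ρ σ τ = record
  { fun = λ { (inj₁ (inj₁ f)) → fun ρ f ; (inj₁ (inj₂ f)) → fun σ f
            ; (inj₂ (f , _)) → fun τ f }
  ; rel = λ { (inj₁ (inj₁ r)) → rel ρ r ; (inj₁ (inj₂ r)) → rel σ r
            ; (inj₂ (r , _)) → rel τ r }
  }

-- Two interpretations over the same domains agree on all rigid symbols
-- (relations are Set-valued, so equality of relations is pointwise ⇔).
RigidAgree : ∀ {n} {V : Sig n} {D : Fin n → Set} → Interp V D → Interp V D → Set
RigidAgree {V = V} {D} I J =
  ((f : FSym V) → fRigid V f ≡ true → (a : All D (fArgs V f)) → fun I f a ≡ fun J f a) ×
  ((r : RSym V) → rRigid V r ≡ true → (a : All D (rArgs V r)) → rel I r a ⇔ rel J r a)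

Theory : ∀ {n} → Sig n → Set₁
Theory V = Sentence V → Set

Countable : Set → Set
Countable A = Σ (A → ℕ) (λ g → Injective _≡_ _≡_ g)

-- A T-word is given by common sort domains D together with the list of
-- interpretations σ₀ … σₙ₋₁ over D (so all sort domains coincide);
-- IsTWord states that every letter is (with D) an element of ⟦T⟧ and
-- that all letters agree on the rigid symbols.
IsTWord : ∀ {n} {S : Sig n} → Theory S → (D : Fin n → Set) → List (Interp S D) → Set₁
IsTWord {n} {S} T D σs =
  ((s : Fin n) → D s) ×
  ((s : Fin n) → Countable (D s)) ×
  All (λ σ → (φ : Sentence S) → T φ → σ ⊨ φ) σs ×
  ((i j : Fin (length σs)) → RigidAgree (L.lookup σs i) (L.lookup σs j))

-- A language: a predicate on words (only its values on T-words matter).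
Language : ∀ {n} → Sig n → Set₂
Language {n} S = (D : Fin n → Set) → List (Interp S D) → Set₁

_·_ : ∀ {n} {S : Sig n} → Language S → Language S → Language S
(L₁ · L₂) D σs = Σ (List _) λ σs₁ → Σ (List _) λ σs₂ →
                 (σs ≡ σs₁ ++ σs₂) × L₁ D σs₁ × L₂ D σs₂

record Automaton {n : ℕ} (S : Sig n) : Set₁ where
  field
    Γ        : Sig n
    Γ-finite : Finite Γ
    φ₀       : Sentence Γ
    φT       : Sentence (TransSig Γ S)
    φF       : Sentence Γ
open Automaton public

-- Steps A ρ σs ρ' : a run segment ρ = ρ₀, ρ₁, …, ρ_k = ρ' induced by σs;
-- consecutive states agree on rigid symbols (hence all states do).
data Steps {n : ℕ} {S : Sig n} (A : Automaton S) {D : Fin n → Set} :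
           Interp (Γ A) D → List (Interp S D) → Interp (Γ A) D → Set₁ where
  done : ∀ {ρ} → Steps A ρ [] ρ
  step : ∀ {ρ σ ρ₁ σs ρₙ} →
         RigidAgree ρ ρ₁ →
         combine ρ σ ρ₁ ⊨ φT A →
         Steps A ρ₁ σs ρₙ →
         Steps A ρ (σ ∷ σs) ρₙ

-- Acceptance.  For the empty word the single state ρ₀ is an arbitrary
-- Γ-structure (no domain constraint, as σ₀ does not exist); otherwise all
-- states live over the domains of the word.
Accepts : ∀ {n} {S : Sig n} → Automaton S → Language S
Accepts A D [] =
  Σ (Structure (Γ A)) λ ρ → (interp ρ ⊨ φ₀ A) × (interp ρ ⊨ φF A)
Accepts A D (σ ∷ σs) =
  Σ (Interp (Γ A) D) λ ρ₀ → Σ (Interp (Γ A) D) λ ρₙ →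
    (ρ₀ ⊨ φ₀ A) × Steps A ρ₀ (σ ∷ σs) ρₙ × (ρₙ ⊨ φF A)

Regular : ∀ {n} {S : Sig n} → Theory S → Language S → Set₁
Regular {n} {S} T L = Σ (Automaton S) λ A →
  (D : Fin n → Set) (σs : List (Interp S D)) → IsTWord T D σs →
  L D σs ⇔ Accepts A D σs

-- The concatenation automaton keeps a state of A₁, a state of A₂ and a
-- nullary flag telling which of the two is running.  While the flag is off
-- it performs A₁-transitions; the transition that switches the flag on
-- demands that the A₁-state be final and the A₂-state initial, and performs
-- an A₂-transition; from then on it performs A₂-transitions.  Empty factors
-- cannot be detected by a run, so whether Aᵢ accepts the empty word is
-- decided by excluded middle and hard-wired (as ⊤ or ⊥) into the initial and
-- final formulas.  Finally, factors of T-words are T-words, so agreement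
-- of L₁, L₂ with the automata on T-words carries over to L₁ · L₂.
module Submission where

open import Defs
open import Level using (0ℓ) renaming (suc to lsuc)
open import Axiom.ExcludedMiddle using (ExcludedMiddle)
open import Data.Nat using (ℕ; _+_)
open import Data.Fin using (Fin)
open import Data.Fin.Properties using (+↔⊎; 0↔⊥; 1↔⊤)
open import Data.Bool using (false)
open import Data.List using (List; []; _∷_; _++_; length; lookup)
open import Data.List.Properties using (++-identityʳ)
open import Data.List.Membership.Propositional using (_∈_)
open import Data.List.Membership.Propositional.Properties using (∈-lookup; ∈-++⁺ˡ; ∈-++⁺ʳ)
open import Data.List.Relation.Unary.All using (All; []; _∷_)
open import Data.List.Relation.Unary.All.Properties using (++⁻)
open import Data.List.Relation.Unary.Any using (index)
open import Data.List.Relation.Unary.Any.Properties using (lookup-index)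
open import Data.Product using (Σ; _×_; _,_; proj₁; proj₂; map₂)
open import Data.Product.Function.NonDependent.Propositional using (_×-⇔_)
open import Data.Sum using (_⊎_; inj₁; inj₂)
open import Data.Sum.Function.Propositional using (_⊎-⇔_; _⊎-↔_)
open import Data.Empty using (⊥; ⊥-elim)
open import Data.Unit using (⊤) renaming (tt to unit)
open import Relation.Nullary using (¬_; Dec; yes; no)
open import Relation.Binary.PropositionalEquality using (_≡_; refl; sym; cong; subst₂)
open import Function using (_∘_; id)
open import Function.Bundles using (_⇔_; mk⇔; Equivalence)
open import Function.Construct.Identity using (⇔-id)
open import Function.Construct.Composition using (_⇔-∘_)
open import Function.Properties.Inverse using (↔-sym; ↔-trans)
open import Function.Related.TypeIsomorphisms using (→-cong-⇔; ¬-cong-⇔)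
open Equivalence using (to; from)

module Translation {n : ℕ} {V W : Sig n}
  (appᵀ  : ∀ {Δ} (f : FSym V) → Terms W Δ (fArgs V f) → Term W Δ (fRes V f))
  (atomᵀ : ∀ {Δ} (r : RSym V) → Terms W Δ (rArgs V r) → Formula W Δ)
  where

  mutual
    translateTerm : ∀ {Δ s} → Term V Δ s → Term W Δ s
    translateTerm (var x)    = var x
    translateTerm (app f ts) = appᵀ f (translateTerms ts)

    translateTerms : ∀ {Δ ss} → Terms V Δ ss → Terms W Δ ss
    translateTerms []       = []
    translateTerms (t ∷ ts) = translateTerm t ∷ translateTerms ts

  translate : ∀ {Δ} → Formula V Δ → Formula W Δ
  translate (atom r ts) = atomᵀ r (translateTerms ts)
  translate (eq t u)    = eq (translateTerm t) (translateTerm u)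
  translate tt          = tt
  translate ff          = ff
  translate (not φ)     = not (translate φ)
  translate (and φ ψ)   = and (translate φ) (translate ψ)
  translate (or φ ψ)    = or (translate φ) (translate ψ)
  translate (imp φ ψ)   = imp (translate φ) (translate ψ)
  translate (all s φ)   = all s (translate φ)
  translate (ex s φ)    = ex s (translate φ)

  module _ {D : Fin n → Set} (I : Interp W D) (J : Interp V D)
    (appᵀ-sound  : ∀ {Δ} (env : All D Δ) f (ts : Terms W Δ (fArgs V f)) →
                   evalT I env (appᵀ f ts) ≡ fun J f (evalTs I env ts))
    (atomᵀ-sound : ∀ {Δ} (env : All D Δ) r (ts : Terms W Δ (rArgs V r)) →
                   Sat I env (atomᵀ r ts) ⇔ rel J r (evalTs I env ts))
    where

    mutual
      evalT-translate : ∀ {Δ s} (env : All D Δ) (t : Term V Δ s) →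
                        evalT I env (translateTerm t) ≡ evalT J env t
      evalT-translate env (var x)    = refl
      evalT-translate env (app f ts) rewrite appᵀ-sound env f (translateTerms ts)
                                           | evalTs-translate env ts = refl

      evalTs-translate : ∀ {Δ ss} (env : All D Δ) (ts : Terms V Δ ss) →
                         evalTs I env (translateTerms ts) ≡ evalTs J env ts
      evalTs-translate env []       = refl
      evalTs-translate env (t ∷ ts) rewrite evalT-translate env t
                                          | evalTs-translate env ts = refl

    Sat-translate : ∀ {Δ} (env : All D Δ) (φ : Formula V Δ) →
                    Sat I env (translate φ) ⇔ Sat J env φ
    Sat-translate env (atom r ts) rewrite sym (evalTs-translate env ts) =
      atomᵀ-sound env r (translateTerms ts)
    Sat-translate env (eq t u) rewrite evalT-translate env t | evalT-translate env u = ⇔-id _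
    Sat-translate env tt        = ⇔-id _
    Sat-translate env ff        = ⇔-id _
    Sat-translate env (not φ)   = ¬-cong-⇔ (Sat-translate env φ)
    Sat-translate env (and φ ψ) = Sat-translate env φ ×-⇔ Sat-translate env ψ
    Sat-translate env (or φ ψ)  = Sat-translate env φ ⊎-⇔ Sat-translate env ψ
    Sat-translate env (imp φ ψ) = →-cong-⇔ (Sat-translate env φ) (Sat-translate env ψ)
    Sat-translate env (all s φ) = mk⇔ (λ h d → to (Sat-translate (d ∷ env) φ) (h d))
                                      (λ h d → from (Sat-translate (d ∷ env) φ) (h d))
    Sat-translate env (ex s φ)  = mk⇔ (map₂ λ {d} → to (Sat-translate (d ∷ env) φ))
                                      (map₂ λ {d} → from (Sat-translate (d ∷ env) φ))

module _ {n : ℕ} {V W : Sig n} {D : Fin n → Set} where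

  reductˡ : Interp (V ⊕ W) D → Interp V D
  reductˡ I = record { fun = λ f → fun I (inj₁ f) ; rel = λ r → rel I (inj₁ r) }

  reductʳ : Interp (V ⊕ W) D → Interp W D
  reductʳ I = record { fun = λ f → fun I (inj₂ f) ; rel = λ r → rel I (inj₂ r) }

  _⊕ᴵ_ : Interp V D → Interp W D → Interp (V ⊕ W) D
  I ⊕ᴵ J = record
    { fun = λ { (inj₁ f) → fun I f ; (inj₂ f) → fun J f }
    ; rel = λ { (inj₁ r) → rel I r ; (inj₂ r) → rel J r }
    }

  RigidAgree-reductˡ : {I J : Interp (V ⊕ W) D} → RigidAgree I J → RigidAgree (reductˡ I) (reductˡ J)
  RigidAgree-reductˡ (fun≡ , rel⇔) = fun≡ ∘ inj₁ , rel⇔ ∘ inj₁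

  RigidAgree-reductʳ : {I J : Interp (V ⊕ W) D} → RigidAgree I J → RigidAgree (reductʳ I) (reductʳ J)
  RigidAgree-reductʳ (fun≡ , rel⇔) = fun≡ ∘ inj₂ , rel⇔ ∘ inj₂

  RigidAgree-⊕ᴵ : {I I′ : Interp V D} {J J′ : Interp W D} →
                  RigidAgree I I′ → RigidAgree J J′ → RigidAgree (I ⊕ᴵ J) (I′ ⊕ᴵ J′)
  RigidAgree-⊕ᴵ (fun≡₁ , rel⇔₁) (fun≡₂ , rel⇔₂) =
    (λ { (inj₁ f) → fun≡₁ f ; (inj₂ f) → fun≡₂ f }) ,
    (λ { (inj₁ r) → rel⇔₁ r ; (inj₂ r) → rel⇔₂ r })

RigidAgree-refl : ∀ {n} {V : Sig n} {D : Fin n → Set} (I : Interp V D) → RigidAgree I I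
RigidAgree-refl I = (λ _ _ _ → refl) , (λ _ _ _ → ⇔-id _)

module _ {n : ℕ} {V W : Sig n} where
  private
    module Left  = Translation {V = V} {W = V ⊕ W} (λ f → app (inj₁ f)) (λ r → atom (inj₁ r))
    module Right = Translation {V = W} {W = V ⊕ W} (λ f → app (inj₂ f)) (λ r → atom (inj₂ r))

  embedˡ : Sentence V → Sentence (V ⊕ W)
  embedˡ = Left.translate

  embedʳ : Sentence W → Sentence (V ⊕ W)
  embedʳ = Right.translate

  ⊨-embedˡ : ∀ {D} (I : Interp (V ⊕ W) D) (φ : Sentence V) → I ⊨ embedˡ φ ⇔ reductˡ I ⊨ φ
  ⊨-embedˡ I = Left.Sat-translate I (reductˡ I) (λ _ _ _ → refl) (λ _ _ _ → ⇔-id _) []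

  ⊨-embedʳ : ∀ {D} (I : Interp (V ⊕ W) D) (φ : Sentence W) → I ⊨ embedʳ φ ⇔ reductʳ I ⊨ φ
  ⊨-embedʳ I = Right.Sat-translate I (reductʳ I) (λ _ _ _ → refl) (λ _ _ _ → ⇔-id _) []

module _ {n : ℕ} {V W S : Sig n} where
  private
    appˡ : ∀ {Δ} (f : FSym (TransSig V S)) → Terms (TransSig (V ⊕ W) S) Δ (fArgs (TransSig V S) f) →
           Term (TransSig (V ⊕ W) S) Δ (fRes (TransSig V S) f)
    appˡ (inj₁ (inj₁ f)) = app (inj₁ (inj₁ (inj₁ f)))
    appˡ (inj₁ (inj₂ f)) = app (inj₁ (inj₂ f))
    appˡ (inj₂ (f , p))  = app (inj₂ (inj₁ f , p))

    atomˡ : ∀ {Δ} (r : RSym (TransSig V S)) → Terms (TransSig (V ⊕ W) S) Δ (rArgs (TransSig V S) r) →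
            Formula (TransSig (V ⊕ W) S) Δ
    atomˡ (inj₁ (inj₁ r)) = atom (inj₁ (inj₁ (inj₁ r)))
    atomˡ (inj₁ (inj₂ r)) = atom (inj₁ (inj₂ r))
    atomˡ (inj₂ (r , p))  = atom (inj₂ (inj₁ r , p))

    appʳ : ∀ {Δ} (f : FSym (TransSig W S)) → Terms (TransSig (V ⊕ W) S) Δ (fArgs (TransSig W S) f) →
           Term (TransSig (V ⊕ W) S) Δ (fRes (TransSig W S) f)
    appʳ (inj₁ (inj₁ f)) = app (inj₁ (inj₁ (inj₂ f)))
    appʳ (inj₁ (inj₂ f)) = app (inj₁ (inj₂ f))
    appʳ (inj₂ (f , p))  = app (inj₂ (inj₂ f , p))

    atomʳ : ∀ {Δ} (r : RSym (TransSig W S)) → Terms (TransSig (V ⊕ W) S) Δ (rArgs (TransSig W S) r) →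
            Formula (TransSig (V ⊕ W) S) Δ
    atomʳ (inj₁ (inj₁ r)) = atom (inj₁ (inj₁ (inj₂ r)))
    atomʳ (inj₁ (inj₂ r)) = atom (inj₁ (inj₂ r))
    atomʳ (inj₂ (r , p))  = atom (inj₂ (inj₂ r , p))

    module Left  = Translation {V = TransSig V S} {W = TransSig (V ⊕ W) S} appˡ atomˡ
    module Right = Translation {V = TransSig W S} {W = TransSig (V ⊕ W) S} appʳ atomʳ

  embedᵀˡ : Sentence (TransSig V S) → Sentence (TransSig (V ⊕ W) S)
  embedᵀˡ = Left.translate

  embedᵀʳ : Sentence (TransSig W S) → Sentence (TransSig (V ⊕ W) S)
  embedᵀʳ = Right.translate

  ⊨-embedᵀˡ : ∀ {D} (ρ ρ′ : Interp (V ⊕ W) D) (σ : Interp S D) (φ : Sentence (TransSig V S)) →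
              combine ρ σ ρ′ ⊨ embedᵀˡ φ ⇔ combine (reductˡ ρ) σ (reductˡ ρ′) ⊨ φ
  ⊨-embedᵀˡ ρ ρ′ σ = Left.Sat-translate (combine ρ σ ρ′) (combine (reductˡ ρ) σ (reductˡ ρ′))
    (λ { _ (inj₁ (inj₁ _)) _ → refl ; _ (inj₁ (inj₂ _)) _ → refl ; _ (inj₂ _) _ → refl })
    (λ { _ (inj₁ (inj₁ _)) _ → ⇔-id _ ; _ (inj₁ (inj₂ _)) _ → ⇔-id _ ; _ (inj₂ _) _ → ⇔-id _ })
    []

  ⊨-embedᵀʳ : ∀ {D} (ρ ρ′ : Interp (V ⊕ W) D) (σ : Interp S D) (φ : Sentence (TransSig W S)) →
              combine ρ σ ρ′ ⊨ embedᵀʳ φ ⇔ combine (reductʳ ρ) σ (reductʳ ρ′) ⊨ φ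
  ⊨-embedᵀʳ ρ ρ′ σ = Right.Sat-translate (combine ρ σ ρ′) (combine (reductʳ ρ) σ (reductʳ ρ′))
    (λ { _ (inj₁ (inj₁ _)) _ → refl ; _ (inj₁ (inj₂ _)) _ → refl ; _ (inj₂ _) _ → refl })
    (λ { _ (inj₁ (inj₁ _)) _ → ⇔-id _ ; _ (inj₁ (inj₂ _)) _ → ⇔-id _ ; _ (inj₂ _) _ → ⇔-id _ })
    []

Finite-⊕ : ∀ {n} {V W : Sig n} → Finite V → Finite W → Finite (V ⊕ W)
Finite-⊕ ((k , funs) , (l , rels)) ((k′ , funs′) , (l′ , rels′)) =
  (k + k′ , ↔-trans (funs ⊎-↔ funs′) (↔-sym +↔⊎)) ,
  (l + l′ , ↔-trans (rels ⊎-↔ rels′) (↔-sym +↔⊎))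

FlagSig : ∀ {n} → Sig n
FlagSig = record
  { FSym = ⊥ ; RSym = ⊤ ; fArgs = λ () ; fRes = λ () ; rArgs = λ _ → []
  ; fRigid = λ () ; rRigid = λ _ → false }

Finite-FlagSig : ∀ {n} → Finite (FlagSig {n})
Finite-FlagSig = (0 , ↔-sym 0↔⊥) , (1 , ↔-sym 1↔⊤)

flagged : ∀ {n} {D : Fin n → Set} → Set → Interp FlagSig D
flagged X = record { fun = λ () ; rel = λ _ _ → X }

RigidAgree-flagged : ∀ {n} {D : Fin n → Set} {X Y : Set} → RigidAgree (flagged {D = D} X) (flagged Y)
RigidAgree-flagged = (λ ()) , (λ _ ())

trivialInterp : ∀ {n} {V : Sig n} {D : Fin n → Set} → ((s : Fin n) → D s) → Interp V D
trivialInterp {V = V} inhabited = record { fun = λ f _ → inhabited (fRes V f) ; rel = λ _ _ → ⊥ }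

decide : ∀ {n ℓ} {V : Sig n} {X : Set ℓ} → Dec X → Sentence V
decide (yes _) = tt
decide (no _)  = ff

⊨-decide : ∀ {n ℓ} {V : Sig n} {D : Fin n → Set} {X : Set ℓ} (d : Dec X) (I : Interp V D) →
           I ⊨ decide d ⇔ X
⊨-decide (yes x) I = mk⇔ (λ _ → x) (λ _ → unit)
⊨-decide (no ¬x) I = mk⇔ (λ ()) ¬x

-- Definitionally equal to Accepts A D [], whatever D is.
AcceptsEmpty : ∀ {n} {S : Sig n} → Automaton S → Set₁
AcceptsEmpty A = Σ (Structure (Γ A)) λ ρ → (interp ρ ⊨ φ₀ A) × (interp ρ ⊨ φF A)

module _ {n : ℕ} {S : Sig n} {A : Automaton S} {D : Fin n → Set} where

  Steps-++ : ∀ {ρ ρ′ ρ″ : Interp (Γ A) D} {xs ys} →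
             Steps A ρ xs ρ′ → Steps A ρ′ ys ρ″ → Steps A ρ (xs ++ ys) ρ″
  Steps-++ done               run′ = run′
  Steps-++ (step agree t run) run′ = step agree t (Steps-++ run run′)

  Steps⇒Accepts : ((s : Fin n) → D s) → ∀ {ρ ρ′ : Interp (Γ A) D} {ws} →
                  ρ ⊨ φ₀ A → Steps A ρ ws ρ′ → ρ′ ⊨ φF A → Accepts A D ws
  Steps⇒Accepts inhabited {ρ} i done f = record { Dom = D ; nonempty = inhabited ; interp = ρ } , i , f
  Steps⇒Accepts inhabited i run@(step _ _ _) f = _ , _ , i , run , f

module Concatenation {n : ℕ} {S : Sig n} (A₁ A₂ : Automaton S)
  (ε∈A₁? : Dec (AcceptsEmpty A₁)) (ε∈A₂? : Dec (AcceptsEmpty A₂)) where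

  Γ₁ Γ₂ StateSig : Sig n
  Γ₁ = Γ A₁
  Γ₂ = Γ A₂
  StateSig = (Γ₁ ⊕ Γ₂) ⊕ FlagSig

  private variable
    D : Fin n → Set
    a a′ : Interp Γ₁ D
    b b′ : Interp Γ₂ D
    ρ ρ′ : Interp StateSig D
    w : Interp S D
    ws : List (Interp S D)

  state₁ : Interp StateSig D → Interp Γ₁ D
  state₁ = reductˡ ∘ reductˡ

  state₂ : Interp StateSig D → Interp Γ₂ D
  state₂ = reductʳ ∘ reductˡ

  InSecond : Interp StateSig D → Set
  InSecond ρ = rel ρ (inj₂ unit) []

  mkState : Interp Γ₁ D → Interp Γ₂ D → Set → Interp StateSig D
  mkState a b X = (a ⊕ᴵ b) ⊕ᴵ flagged X

  RigidAgree-mkState : {X Y : Set} → RigidAgree a a′ → RigidAgree b b′ →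
                       RigidAgree (mkState a b X) (mkState a′ b′ Y)
  RigidAgree-mkState a~a′ b~b′ = RigidAgree-⊕ᴵ (RigidAgree-⊕ᴵ a~a′ b~b′) RigidAgree-flagged

  RigidAgree-state₁ : RigidAgree ρ ρ′ → RigidAgree (state₁ ρ) (state₁ ρ′)
  RigidAgree-state₁ = RigidAgree-reductˡ ∘ RigidAgree-reductˡ

  RigidAgree-state₂ : RigidAgree ρ ρ′ → RigidAgree (state₂ ρ) (state₂ ρ′)
  RigidAgree-state₂ = RigidAgree-reductʳ ∘ RigidAgree-reductˡ

  on₁ : Sentence Γ₁ → Sentence StateSig
  on₁ = embedˡ ∘ embedˡ

  on₂ : Sentence Γ₂ → Sentence StateSig
  on₂ = embedˡ ∘ embedʳ

  now : Sentence StateSig → Sentence (TransSig StateSig S)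
  now = embedˡ ∘ embedˡ

  onᵀ₁ : Sentence (TransSig Γ₁ S) → Sentence (TransSig StateSig S)
  onᵀ₁ = embedᵀˡ ∘ embedᵀˡ

  onᵀ₂ : Sentence (TransSig Γ₂ S) → Sentence (TransSig StateSig S)
  onᵀ₂ = embedᵀˡ ∘ embedᵀʳ

  ⊨-on₁ : (ρ : Interp StateSig D) (φ : Sentence Γ₁) → ρ ⊨ on₁ φ ⇔ state₁ ρ ⊨ φ
  ⊨-on₁ ρ φ = ⊨-embedˡ (reductˡ ρ) φ ⇔-∘ ⊨-embedˡ ρ (embedˡ φ)

  ⊨-on₂ : (ρ : Interp StateSig D) (φ : Sentence Γ₂) → ρ ⊨ on₂ φ ⇔ state₂ ρ ⊨ φ
  ⊨-on₂ ρ φ = ⊨-embedʳ (reductˡ ρ) φ ⇔-∘ ⊨-embedˡ ρ (embedʳ φ)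

  ⊨-now : (ρ : Interp StateSig D) (σ : Interp S D) (ρ′ : Interp StateSig D)
          (φ : Sentence StateSig) →
          combine ρ σ ρ′ ⊨ now φ ⇔ ρ ⊨ φ
  ⊨-now ρ σ ρ′ φ =
    ⊨-embedˡ (reductˡ (combine ρ σ ρ′)) φ ⇔-∘ ⊨-embedˡ (combine ρ σ ρ′) (embedˡ φ)

  ⊨-onᵀ₁ : (ρ : Interp StateSig D) (σ : Interp S D) (ρ′ : Interp StateSig D)
           (φ : Sentence (TransSig Γ₁ S)) →
           combine ρ σ ρ′ ⊨ onᵀ₁ φ ⇔ combine (state₁ ρ) σ (state₁ ρ′) ⊨ φ
  ⊨-onᵀ₁ ρ σ ρ′ φ = ⊨-embedᵀˡ (reductˡ ρ) (reductˡ ρ′) σ φ ⇔-∘ ⊨-embedᵀˡ ρ ρ′ σ (embedᵀˡ φ)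

  ⊨-onᵀ₂ : (ρ : Interp StateSig D) (σ : Interp S D) (ρ′ : Interp StateSig D)
           (φ : Sentence (TransSig Γ₂ S)) →
           combine ρ σ ρ′ ⊨ onᵀ₂ φ ⇔ combine (state₂ ρ) σ (state₂ ρ′) ⊨ φ
  ⊨-onᵀ₂ ρ σ ρ′ φ = ⊨-embedᵀʳ (reductˡ ρ) (reductˡ ρ′) σ φ ⇔-∘ ⊨-embedᵀˡ ρ ρ′ σ (embedᵀʳ φ)

  inSecond : Sentence StateSig
  inSecond = atom (inj₂ unit) []

  inSecondNext : Sentence (TransSig StateSig S)
  inSecondNext = atom (inj₂ (inj₂ unit , refl)) []

  initial : Sentence StateSig
  initial = or (and (not inSecond) (on₁ (φ₀ A₁)))
               (and inSecond (and (on₂ (φ₀ A₂)) (decide ε∈A₁?)))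

  transition : Sentence (TransSig StateSig S)
  transition =
    or (and (not (now inSecond)) (and (not inSecondNext) (onᵀ₁ (φT A₁))))
       (or (and (not (now inSecond)) (and inSecondNext
              (and (now (on₁ (φF A₁))) (and (now (on₂ (φ₀ A₂))) (onᵀ₂ (φT A₂))))))
           (and (now inSecond) (and inSecondNext (onᵀ₂ (φT A₂)))))

  final : Sentence StateSig
  final = or (and inSecond (on₂ (φF A₂)))
             (and (not inSecond) (and (on₁ (φF A₁)) (decide ε∈A₂?)))

  automaton : Automaton S
  automaton = record
    { Γ = StateSig
    ; Γ-finite = Finite-⊕ {V = Γ₁ ⊕ Γ₂} {W = FlagSig}
                 (Finite-⊕ {V = Γ₁} {W = Γ₂} (Γ-finite A₁) (Γ-finite A₂)) (Finite-FlagSig {n})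
    ; φ₀ = initial
    ; φT = transition
    ; φF = final
    }

  data Initial {D : Fin n → Set} (ρ : Interp StateSig D) : Set₁ where
    start₁ : ¬ InSecond ρ → state₁ ρ ⊨ φ₀ A₁ → Initial ρ
    start₂ : InSecond ρ → state₂ ρ ⊨ φ₀ A₂ → AcceptsEmpty A₁ → Initial ρ

  data Transition {D : Fin n → Set} (ρ : Interp StateSig D) (σ : Interp S D)
                  (ρ′ : Interp StateSig D) : Set where
    stay₁  : ¬ InSecond ρ → ¬ InSecond ρ′ →
             combine (state₁ ρ) σ (state₁ ρ′) ⊨ φT A₁ → Transition ρ σ ρ′
    switch : ¬ InSecond ρ → InSecond ρ′ → state₁ ρ ⊨ φF A₁ → state₂ ρ ⊨ φ₀ A₂ →
             combine (state₂ ρ) σ (state₂ ρ′) ⊨ φT A₂ → Transition ρ σ ρ′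
    stay₂  : InSecond ρ → InSecond ρ′ →
             combine (state₂ ρ) σ (state₂ ρ′) ⊨ φT A₂ → Transition ρ σ ρ′

  data Final {D : Fin n → Set} (ρ : Interp StateSig D) : Set₁ where
    accept₁ : ¬ InSecond ρ → state₁ ρ ⊨ φF A₁ → AcceptsEmpty A₂ → Final ρ
    accept₂ : InSecond ρ → state₂ ρ ⊨ φF A₂ → Final ρ

  ⊨-initial : (ρ : Interp StateSig D) → ρ ⊨ initial ⇔ Initial ρ
  ⊨-initial ρ = mk⇔
    (λ { (inj₁ (¬p , i))     → start₁ ¬p (to (⊨-on₁ ρ (φ₀ A₁)) i)
       ; (inj₂ (p , i , ε₁)) → start₂ p (to (⊨-on₂ ρ (φ₀ A₂)) i) (to (⊨-decide ε∈A₁? ρ) ε₁) })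
    (λ { (start₁ ¬p i)   → inj₁ (¬p , from (⊨-on₁ ρ (φ₀ A₁)) i)
       ; (start₂ p i ε₁) → inj₂ (p , from (⊨-on₂ ρ (φ₀ A₂)) i , from (⊨-decide ε∈A₁? ρ) ε₁) })

  ⊨-transition : (ρ : Interp StateSig D) (σ : Interp S D) (ρ′ : Interp StateSig D) →
                 combine ρ σ ρ′ ⊨ transition ⇔ Transition ρ σ ρ′
  ⊨-transition ρ σ ρ′ = mk⇔
    (λ { (inj₁ (¬p , ¬p′ , t))               → stay₁ ¬p ¬p′ (to moves₁ t)
       ; (inj₂ (inj₁ (¬p , p′ , f , i , t))) → switch ¬p p′ (to final₁ f) (to initial₂ i) (to moves₂ t)
       ; (inj₂ (inj₂ (p , p′ , t)))          → stay₂ p p′ (to moves₂ t) })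
    (λ { (stay₁ ¬p ¬p′ t)     → inj₁ (¬p , ¬p′ , from moves₁ t)
       ; (switch ¬p p′ f i t) → inj₂ (inj₁ (¬p , p′ , from final₁ f , from initial₂ i , from moves₂ t))
       ; (stay₂ p p′ t)       → inj₂ (inj₂ (p , p′ , from moves₂ t)) })
    where
      moves₁ : combine ρ σ ρ′ ⊨ onᵀ₁ (φT A₁) ⇔ combine (state₁ ρ) σ (state₁ ρ′) ⊨ φT A₁
      moves₁ = ⊨-onᵀ₁ ρ σ ρ′ (φT A₁)

      moves₂ : combine ρ σ ρ′ ⊨ onᵀ₂ (φT A₂) ⇔ combine (state₂ ρ) σ (state₂ ρ′) ⊨ φT A₂
      moves₂ = ⊨-onᵀ₂ ρ σ ρ′ (φT A₂)

      final₁ : combine ρ σ ρ′ ⊨ now (on₁ (φF A₁)) ⇔ state₁ ρ ⊨ φF A₁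
      final₁ = ⊨-on₁ ρ (φF A₁) ⇔-∘ ⊨-now ρ σ ρ′ (on₁ (φF A₁))

      initial₂ : combine ρ σ ρ′ ⊨ now (on₂ (φ₀ A₂)) ⇔ state₂ ρ ⊨ φ₀ A₂
      initial₂ = ⊨-on₂ ρ (φ₀ A₂) ⇔-∘ ⊨-now ρ σ ρ′ (on₂ (φ₀ A₂))

  ⊨-final : (ρ : Interp StateSig D) → ρ ⊨ final ⇔ Final ρ
  ⊨-final ρ = mk⇔
    (λ { (inj₁ (p , f))       → accept₂ p (to (⊨-on₂ ρ (φF A₂)) f)
       ; (inj₂ (¬p , f , ε₂)) → accept₁ ¬p (to (⊨-on₁ ρ (φF A₁)) f) (to (⊨-decide ε∈A₂? ρ) ε₂) })
    (λ { (accept₂ p f)     → inj₁ (p , from (⊨-on₂ ρ (φF A₂)) f)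
       ; (accept₁ ¬p f ε₂) → inj₂ (¬p , from (⊨-on₁ ρ (φF A₁)) f , from (⊨-decide ε∈A₂? ρ) ε₂) })

  lift₁ : (b : Interp Γ₂ D) → Steps A₁ a ws a′ → Steps automaton (mkState a b ⊥) ws (mkState a′ b ⊥)
  lift₁ b done = done
  lift₁ {a = a} b (step {σ = σ} {ρ₁ = a₁} a~a₁ t run) =
    step (RigidAgree-mkState a~a₁ (RigidAgree-refl b))
         (from (⊨-transition (mkState a b ⊥) σ (mkState a₁ b ⊥)) (stay₁ id id t))
         (lift₁ b run)

  lift₂ : (a : Interp Γ₁ D) → Steps A₂ b ws b′ → Steps automaton (mkState a b ⊤) ws (mkState a b′ ⊤)
  lift₂ a done = done
  lift₂ {b = b} a (step {σ = σ} {ρ₁ = b₁} b~b₁ t run) =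
    step (RigidAgree-mkState (RigidAgree-refl a) b~b₁)
         (from (⊨-transition (mkState a b ⊤) σ (mkState a b₁ ⊤)) (stay₂ unit unit t))
         (lift₂ a run)

  switch-run : a ⊨ φF A₁ → b ⊨ φ₀ A₂ → Steps A₂ b (w ∷ ws) b′ →
               Steps automaton (mkState a b ⊥) (w ∷ ws) (mkState a b′ ⊤)
  switch-run {a = a} {b = b} f i (step {σ = σ} {ρ₁ = b₁} b~b₁ t run) =
    step (RigidAgree-mkState (RigidAgree-refl a) b~b₁)
         (from (⊨-transition (mkState a b ⊥) σ (mkState a b₁ ⊤)) (switch id unit f i t))
         (lift₂ a run)

  second-phase-run : Steps automaton ρ ws ρ′ → InSecond ρ →
                     InSecond ρ′ × Steps A₂ (state₂ ρ) ws (state₂ ρ′)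
  second-phase-run done p = p , done
  second-phase-run (step ρ~ρ₁ t run) p with to (⊨-transition _ _ _) t
  ... | stay₁ ¬p _ _      = ⊥-elim (¬p p)
  ... | switch ¬p _ _ _ _ = ⊥-elim (¬p p)
  ... | stay₂ _ p₁ t₂     = map₂ (step (RigidAgree-state₂ ρ~ρ₁) t₂) (second-phase-run run p₁)

  record Switched {D : Fin n → Set} (ρ : Interp StateSig D) (ws : List (Interp S D))
                  (ρ′ : Interp StateSig D) : Set₁ where
    field
      prefix suffix : List (Interp S D)
      split         : ws ≡ prefix ++ suffix
      last₁         : Interp Γ₁ D
      run₁          : Steps A₁ (state₁ ρ) prefix last₁
      final₁        : last₁ ⊨ φF A₁
      first₂        : Interp Γ₂ D
      initial₂      : first₂ ⊨ φ₀ A₂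
      run₂          : Steps A₂ first₂ suffix (state₂ ρ′)
      second        : InSecond ρ′

  first-phase-run : Steps automaton ρ ws ρ′ → ¬ InSecond ρ →
                    (¬ InSecond ρ′ × Steps A₁ (state₁ ρ) ws (state₁ ρ′)) ⊎ Switched ρ ws ρ′
  first-phase-run done ¬p = inj₁ (¬p , done)
  first-phase-run {ρ = ρ} (step ρ~ρ₁ t run) ¬p with to (⊨-transition _ _ _) t
  ... | stay₂ p _ _ = ⊥-elim (¬p p)
  ... | switch _ p₁ f i t₂ =
    let p′ , run₂ = second-phase-run run p₁ in
    inj₂ (record
      { prefix = [] ; suffix = _ ; split = refl
      ; last₁ = state₁ ρ ; run₁ = done ; final₁ = f
      ; first₂ = state₂ ρ ; initial₂ = i ; run₂ = step (RigidAgree-state₂ ρ~ρ₁) t₂ run₂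
      ; second = p′ })
  ... | stay₁ _ ¬p₁ t₁ with first-phase-run run ¬p₁
  ...   | inj₁ (¬p′ , run₁) = inj₁ (¬p′ , step (RigidAgree-state₁ ρ~ρ₁) t₁ run₁)
  ...   | inj₂ sw = inj₂ (record
      { prefix = _ ∷ prefix ; suffix = suffix ; split = cong (_ ∷_) split
      ; last₁ = last₁ ; run₁ = step (RigidAgree-state₁ ρ~ρ₁) t₁ run₁ ; final₁ = final₁
      ; first₂ = first₂ ; initial₂ = initial₂ ; run₂ = run₂
      ; second = second })
    where open Switched sw

  Final⇒second : Final ρ → InSecond ρ → state₂ ρ ⊨ φF A₂
  Final⇒second (accept₁ ¬p _ _) p = ⊥-elim (¬p p)
  Final⇒second (accept₂ _ f)    _ = f

  Final⇒first : Final ρ → ¬ InSecond ρ → state₁ ρ ⊨ φF A₁ × AcceptsEmpty A₂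
  Final⇒first (accept₁ _ f ε₂) _  = f , ε₂
  Final⇒first (accept₂ p _)    ¬p = ⊥-elim (¬p p)

  run⇒concat : ((s : Fin n) → D s) → Initial ρ → Steps automaton ρ ws ρ′ → Final ρ′ →
               (Accepts A₁ · Accepts A₂) D ws
  run⇒concat inhabited (start₂ p i ε₁) run f =
    let p′ , run₂ = second-phase-run run p in
    [] , _ , refl , ε₁ , Steps⇒Accepts inhabited i run₂ (Final⇒second f p′)
  run⇒concat inhabited (start₁ ¬p i) run f with first-phase-run run ¬p
  ... | inj₁ (¬p′ , run₁) =
    let f₁ , ε₂ = Final⇒first f ¬p′ in
    _ , [] , sym (++-identityʳ _) , Steps⇒Accepts inhabited i run₁ f₁ , ε₂
  ... | inj₂ sw =
    prefix , suffix , split ,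
    Steps⇒Accepts inhabited i run₁ final₁ ,
    Steps⇒Accepts inhabited initial₂ run₂ (Final⇒second f second)
    where open Switched sw

  accepts⇒concat : ((s : Fin n) → D s) → ∀ ws → Accepts automaton D ws → (Accepts A₁ · Accepts A₂) D ws
  accepts⇒concat _ [] (R , i , f) with to (⊨-initial (interp R)) i
  ... | start₁ ¬p i₁ =
    let f₁ , ε₂ = Final⇒first (to (⊨-final (interp R)) f) ¬p in
    [] , [] , refl , Steps⇒Accepts {A = A₁} (nonempty R) i₁ done f₁ , ε₂
  ... | start₂ p i₂ ε₁ =
    [] , [] , refl , ε₁ ,
    Steps⇒Accepts {A = A₂} (nonempty R) i₂ done (Final⇒second (to (⊨-final (interp R)) f) p)
  accepts⇒concat inhabited (_ ∷ _) (ρ , ρ′ , i , run , f) =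
    run⇒concat inhabited (to (⊨-initial ρ) i) run (to (⊨-final ρ′) f)

  concat⇒accepts : ((s : Fin n) → D s) → (Accepts A₁ · Accepts A₂) D ws → Accepts automaton D ws
  concat⇒accepts _ ([] , [] , refl , (R , i , f) , ε₂) =
    record { Dom = Dom R ; nonempty = nonempty R ; interp = ρ₀ } ,
    from (⊨-initial ρ₀) (start₁ id i) , from (⊨-final ρ₀) (accept₁ id f ε₂)
    where
      ρ₀ : Interp StateSig (Dom R)
      ρ₀ = mkState (interp R) (trivialInterp (nonempty R)) ⊥
  concat⇒accepts inhabited ([] , _ ∷ _ , refl , ε₁ , (b , b′ , i , run , f)) =
    mkState (trivialInterp inhabited) b ⊤ , mkState (trivialInterp inhabited) b′ ⊤ ,
    from (⊨-initial _) (start₂ unit i ε₁) , lift₂ (trivialInterp inhabited) run ,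
    from (⊨-final _) (accept₂ unit f)
  concat⇒accepts inhabited (_ ∷ xs , [] , refl , (a , a′ , i , run , f) , ε₂) rewrite ++-identityʳ xs =
    mkState a (trivialInterp inhabited) ⊥ , mkState a′ (trivialInterp inhabited) ⊥ ,
    from (⊨-initial _) (start₁ id i) , lift₁ (trivialInterp inhabited) run ,
    from (⊨-final _) (accept₁ id f ε₂)
  concat⇒accepts _ (_ ∷ _ , _ ∷ _ , refl , (a , a′ , i , run₁ , f) , (b , b′ , j , run₂ , g)) =
    mkState a b ⊥ , mkState a′ b′ ⊤ ,
    from (⊨-initial _) (start₁ id i) , Steps-++ (lift₁ b run₁) (switch-run f j run₂) ,
    from (⊨-final _) (accept₂ unit g)

  concat⇔accepts : ((s : Fin n) → D s) → ∀ ws → (Accepts A₁ · Accepts A₂) D ws ⇔ Accepts automaton D ws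
  concat⇔accepts inhabited ws = mk⇔ (concat⇒accepts inhabited) (accepts⇒concat inhabited ws)

RigidAgree-∈ : ∀ {n} {V : Sig n} {D : Fin n → Set} {zs : List (Interp V D)} →
               ((i j : Fin (length zs)) → RigidAgree (lookup zs i) (lookup zs j)) →
               ∀ {x y} → x ∈ zs → y ∈ zs → RigidAgree x y
RigidAgree-∈ agree x∈zs y∈zs =
  subst₂ RigidAgree (sym (lookup-index x∈zs)) (sym (lookup-index y∈zs)) (agree (index x∈zs) (index y∈zs))

module _ {n : ℕ} {S : Sig n} (T : Theory S) where

  IsTWord-++⁻ : ∀ {D} xs {ys} → IsTWord T D (xs ++ ys) → IsTWord T D xs × IsTWord T D ys
  IsTWord-++⁻ xs {ys} (inhabited , countable , models , agree) =
    (inhabited , countable , proj₁ (++⁻ xs models) ,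
     λ i j → RigidAgree-∈ agree (∈-++⁺ˡ (∈-lookup {xs = xs} i)) (∈-++⁺ˡ (∈-lookup {xs = xs} j))) ,
    (inhabited , countable , proj₂ (++⁻ xs models) ,
     λ i j → RigidAgree-∈ agree (∈-++⁺ʳ xs (∈-lookup {xs = ys} i)) (∈-++⁺ʳ xs (∈-lookup {xs = ys} j)))

  AgreeOn : Language S → Language S → Set₁
  AgreeOn L K = (D : Fin n → Set) (σs : List (Interp S D)) → IsTWord T D σs → L D σs ⇔ K D σs

  ·-map : ∀ {L₁ L₂ K₁ K₂ : Language S} {D σs} →
          (∀ {xs} → IsTWord T D xs → L₁ D xs → K₁ D xs) →
          (∀ {ys} → IsTWord T D ys → L₂ D ys → K₂ D ys) →
          IsTWord T D σs → (L₁ · L₂) D σs → (K₁ · K₂) D σs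
  ·-map f g tw (xs , ys , refl , l₁ , l₂) =
    let tw₁ , tw₂ = IsTWord-++⁻ xs tw in xs , ys , refl , f tw₁ l₁ , g tw₂ l₂

  ·-cong : ∀ {L₁ L₂ K₁ K₂ : Language S} → AgreeOn L₁ K₁ → AgreeOn L₂ K₂ → AgreeOn (L₁ · L₂) (K₁ · K₂)
  ·-cong {L₁} {L₂} {K₁} {K₂} L₁≈K₁ L₂≈K₂ D σs tw = mk⇔
    (·-map {L₁} {L₂} {K₁} {K₂} (λ {xs} → to   ∘ L₁≈K₁ D xs) (λ {ys} → to   ∘ L₂≈K₂ D ys) tw)
    (·-map {K₁} {K₂} {L₁} {L₂} (λ {xs} → from ∘ L₁≈K₁ D xs) (λ {ys} → from ∘ L₂≈K₂ D ys) tw)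

theorem4 : ExcludedMiddle (lsuc 0ℓ) →
    {n : ℕ} (S : Sig n) → Finite S → (T : Theory S) →
    (L₁ L₂ : Language S) → Regular T L₁ → Regular T L₂ →
    Regular T (L₁ · L₂)
theorem4 em S _ T L₁ L₂ (A₁ , L₁≈A₁) (A₂ , L₂≈A₂) =
  automaton , λ D σs tw → concat⇔accepts (proj₁ tw) σs ⇔-∘ ·-cong T L₁≈A₁ L₂≈A₂ D σs tw
  where open Concatenation A₁ A₂ em em
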